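{- Let $\Gamma$ be a finite regular graph with at least one edge and let $n$ be a positive integer. Then $\Gamma$ is a pseudocover of the complete graph $K_n$ if and only if $V(\Gamma)$ admits a partition $\{C_1, \ldots, C_n\}$ such that each $C_i$ ($i = 1, \ldots, n$) is a total perfect code in $\Gamma$.
   Context: All graphs are finite, simple and undirected. A total perfect code in a graph $\Gamma$ is a subset $C \subseteq V(\Gamma)$ such that every vertex of $\Gamma$ is adjacent to exactly one vertex of $C$. A covering projection from a graph $\Sigma$ to a graph $\Gamma$ is a surjective map $p: V(\Sigma) \to V(\Gamma)$ such that for every $u \in V(\Sigma)$ the restriction of $p$ to the neighbourhood $\Sigma(u)$ is a bijection onto $\Gamma(p(u))$. A graph $\Sigma$ is a pseudocover of a graph $\Gamma$ if there exists a surjective map $p: V(\Sigma) \to V(\Gamma)$ (a pseudocovering, with fibres $p^{ -1}(v)$) such that for every $v \in V(\Gamma)$ the induced subgraph $\Sigma[p^{ -1}(v)]$ is a matching (every vertex of $p^{ -1}(v)$ has exactly one neighbour in $p^{ -1}(v)$), and $p$ is a covering projection from $\Sigma^*$ to $\Gamma$, where $\Sigma^*$ is obtained from $\Sigma$ by deleting the edges of each $\Sigma[p^{ -1}(v)]$. -}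

module Defs where

open import Level using (0ℓ)
open import Data.Nat using (ℕ)
open import Data.Fin using (Fin)
open import Data.Fin.Properties using (_≟_)
open import Data.List using (length; filter; allFin)
open import Data.Product using (Σ; ∃; ∃-syntax; _×_; _,_)
open import Relation.Nullary using (¬_; Dec; ¬?)
open import Relation.Nullary.Decidable using (_×-dec_)
open import Relation.Binary.PropositionalEquality using (_≡_)

record Graph (N : ℕ) : Set₁ where
  field
    Adj   : Fin N → Fin N → Set
    sym   : ∀ {u v} → Adj u v → Adj v u
    irref : ∀ {u} → ¬ Adj u u
    adj?  : ∀ u v → Dec (Adj u v)
open Graph public

∃! : ∀ {N} → (Fin N → Set) → Set
∃! {N} P = Σ (Fin N) λ x → P x × (∀ y → P y → y ≡ x)

degree : ∀ {N} (G : Graph N) → Fin N → ℕ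
degree {N} G v = length (filter (adj? G v) (allFin N))

Regular : ∀ {N} → Graph N → Set
Regular {N} G = ∃[ k ] (∀ (v : Fin N) → degree G v ≡ k)

HasEdge : ∀ {N} → Graph N → Set
HasEdge G = ∃[ u ] ∃[ v ] Adj G u v

K : (n : ℕ) → Graph n
K n = record
  { Adj = λ u v → ¬ (u ≡ v)
  ; sym = λ ne e → ne (Relation.Binary.PropositionalEquality.sym e)
  ; irref = λ ne → ne Relation.Binary.PropositionalEquality.refl
  ; adj? = λ u v → ¬? (u ≟ v)
  }

Surjective : ∀ {N M} → (Fin N → Fin M) → Set
Surjective {N} {M} p = ∀ (y : Fin M) → ∃[ x ] p x ≡ y

IsCoveringProjection : ∀ {N M} → Graph N → Graph M → (Fin N → Fin M) → Set
IsCoveringProjection {N} {M} S G p =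
  Surjective p ×
  (∀ (u : Fin N) →
     (∀ w → Adj S u w → Adj G (p u) (p w)) ×
     (∀ w w′ → Adj S u w → Adj S u w′ → p w ≡ p w′ → w ≡ w′) ×
     (∀ y → Adj G (p u) y → ∃[ w ] (Adj S u w × p w ≡ y)))

deleteFibreEdges : ∀ {N M} → Graph N → (Fin N → Fin M) → Graph N
deleteFibreEdges S p = record
  { Adj = λ u w → Adj S u w × ¬ (p u ≡ p w)
  ; sym = λ { (a , ne) → sym S a , (λ e → ne (Relation.Binary.PropositionalEquality.sym e)) }
  ; irref = λ { (a , _) → irref S a }
  ; adj? = λ u w → adj? S u w ×-dec ¬? (p u ≟ p w)
  }

IsPseudocovering : ∀ {N M} → Graph N → Graph M → (Fin N → Fin M) → Set
IsPseudocovering {N} S G p =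
  Surjective p ×
  -- each Σ[p⁻¹(v)] is a matching: each vertex has exactly one neighbour in its fibre
  (∀ (u : Fin N) → ∃! (λ w → Adj S u w × p w ≡ p u)) ×
  IsCoveringProjection (deleteFibreEdges S p) G p

IsPseudocover : ∀ {N M} → Graph N → Graph M → Set
IsPseudocover {N} {M} S G = ∃[ p ] IsPseudocovering {N} {M} S G p

TotalPerfectCode : ∀ {N} → Graph N → (Fin N → Set) → Set
TotalPerfectCode {N} G C = ∀ (v : Fin N) → ∃! (λ w → Adj G v w × C w)

-- A partition {C_1,…,C_n} of Fin N into n (nonempty, pairwise disjoint) blocks,
-- given by the block-assignment map c, with C_i = c⁻¹(i).
Block : ∀ {N n} → (Fin N → Fin n) → Fin n → Fin N → Set
Block c i v = c v ≡ i

IsPartition : ∀ {N n} → (Fin N → Fin n) → Set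
IsPartition {N} {n} c = ∀ (i : Fin n) → ∃[ v ] Block c i v

module Submission where

-- For a map c : V(Γ) → V(Kₙ) and a vertex u, write
-- "u sees block i exactly once" when u has exactly one neighbour w with c w ≡ i.
-- Then "every block c⁻¹(i) is a total perfect code" says precisely that every
-- vertex sees every block exactly once, and this splits into two halves:
--   * u sees its own block c⁻¹(c u) exactly once — the matching condition of a
--     pseudocovering;
--   * u sees every other block exactly once — which, because any two distinct
--     vertices of Kₙ are adjacent, is exactly the condition that c is a covering
--     projection from Γ* (Γ with the edges inside blocks deleted) onto Kₙ.

open import Defs
open import Data.Nat using (ℕ; NonZero)
open import Data.Fin using (Fin)
open import Data.Fin.Properties using (_≟_)
open import Data.Product using (_×_; ∃-syntax; _,_; proj₁)
open import Relation.Nullary using (¬_; yes; no)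
open import Relation.Binary.PropositionalEquality using (_≡_; refl; trans) renaming (sym to ≡-sym)

∃!-cong : ∀ {N} {P Q : Fin N → Set} →
          (∀ w → P w → Q w) → (∀ w → Q w → P w) → ∃! P → ∃! Q
∃!-cong P⇒Q Q⇒P (x , px , unique) = x , P⇒Q x px , λ y qy → unique y (Q⇒P y qy)

module _ {N n : ℕ} (Γ : Graph N) (c : Fin N → Fin n) where

  SeesOnce : Fin N → Fin n → Set
  SeesOnce u i = ∃! (λ w → Adj Γ u w × c w ≡ i)

  Γ* : Graph N
  Γ* = deleteFibreEdges Γ c

  -- In a covering Γ* → Kₙ, every vertex sees every block other than its own
  -- exactly once: Kₙ-adjacency gives existence, injectivity on Γ*(u) uniqueness.
  covering⇒seesOtherBlocksOnce : IsCoveringProjection Γ* (K n) c →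
                                 ∀ u i → ¬ c u ≡ i → SeesOnce u i
  covering⇒seesOtherBlocksOnce (_ , local) u i cu≢i
    with local u
  ... | _ , injective , onto
    with onto i cu≢i
  ... | w , (u~w , cu≢cw) , cw≡i = w , (u~w , cw≡i) , unique
    where
    unique : ∀ y → Adj Γ u y × c y ≡ i → y ≡ w
    unique y (u~y , cy≡i) =
      injective y w (u~y , λ cu≡cy → cu≢i (trans cu≡cy cy≡i)) (u~w , cu≢cw)
                (trans cy≡i (≡-sym cw≡i))

  seesOtherBlocksOnce⇒covering : Surjective c →
                                 (∀ u i → ¬ c u ≡ i → SeesOnce u i) →
                                 IsCoveringProjection Γ* (K n) c
  seesOtherBlocksOnce⇒covering surjective seesOnce =
    surjective , λ u → into u , injective u , onto u
    where
    into : ∀ u w → Adj Γ* u w → Adj (K n) (c u) (c w)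
    into u w (_ , cu≢cw) = cu≢cw

    injective : ∀ u w w′ → Adj Γ* u w → Adj Γ* u w′ → c w ≡ c w′ → w ≡ w′
    injective u w w′ (u~w , _) (u~w′ , cu≢cw′) cw≡cw′
      with seesOnce u (c w′) cu≢cw′
    ... | _ , _ , unique = trans (unique w (u~w , cw≡cw′)) (≡-sym (unique w′ (u~w′ , refl)))

    onto : ∀ u i → Adj (K n) (c u) i → ∃[ w ] (Adj Γ* u w × c w ≡ i)
    onto u i cu≢i with seesOnce u i cu≢i
    ... | w , (u~w , cw≡i) , _ = w , (u~w , λ cu≡cw → cu≢i (trans cu≡cw cw≡i)) , cw≡i

  -- The blocks of a pseudocovering of Kₙ are total perfect codes: the own block
  -- is seen once by the matching condition, every other one by the covering.
  pseudocovering⇒blocksAreCodes : IsPseudocovering Γ (K n) c →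
                                 ∀ i → TotalPerfectCode Γ (Block c i)
  pseudocovering⇒blocksAreCodes (_ , matching , covering) i v with c v ≟ i
  ... | yes cv≡i = ∃!-cong (λ w (v~w , cw≡cv) → v~w , trans cw≡cv cv≡i)
                           (λ w (v~w , cw≡i) → v~w , trans cw≡i (≡-sym cv≡i))
                           (matching v)
  ... | no cv≢i = covering⇒seesOtherBlocksOnce covering v i cv≢i

  codePartition⇒pseudocovering : IsPartition c → (∀ i → TotalPerfectCode Γ (Block c i)) →
                                 IsPseudocovering Γ (K n) c
  codePartition⇒pseudocovering surjective codes =
    surjective ,
    (λ u → codes (c u) u) ,
    seesOtherBlocksOnce⇒covering surjective (λ u i _ → codes i u)

lemma2p5 : ∀ {N} (Γ : Graph N) → Regular Γ → HasEdge Γ → (n : ℕ) → NonZero n →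
           (IsPseudocover Γ (K n) → ∃[ c ] (IsPartition {N} {n} c × (∀ i → TotalPerfectCode Γ (Block c i)))) ×
           (∃[ c ] (IsPartition {N} {n} c × (∀ i → TotalPerfectCode Γ (Block c i))) → IsPseudocover Γ (K n))
lemma2p5 Γ _ _ n _ =
  (λ (p , pseudo) → p , proj₁ pseudo , pseudocovering⇒blocksAreCodes Γ p pseudo) ,
  (λ (c , partition , codes) → c , codePartition⇒pseudocovering Γ c partition codes)
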